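{- Let $A$ be an integral domain with fraction field $K$, and let $R=\begin{pmatrix}A&B\\C&A\end{pmatrix}$ be a faithful generalized matrix algebra over $A$, with multiplication map $m:B\otimes_AC\to A$. Then there exist injective $A$-module maps $i:B\to K$ and $j:C\to K$ such that $m(b,c)=i(b)j(c)$ for all $b\in B$, $c\in C$.
   Context: A generalized matrix algebra (GMA) over $A$ is given by $A$-modules $B,C$ and an $A$-linear map $m:B\otimes_AC\to A$ with $m(b,c)b'=m(b',c)b$ and $m(b,c')c=m(b,c)c'$ for all $b,b'\in B,c,c'\in C$; $R=A\oplus B\oplus C\oplus A$ with matrix-like multiplication. It is faithful if $m$ is non-degenerate: the only $b\in B$ with $m(b,c)=0$ for all $c\in C$ is $b=0$, and the only $c\in C$ with $m(b,c)=0$ for all $b\in B$ is $c=0$. -}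

module Defs where

open import Level using (Level; _⊔_)
open import Algebra.Bundles using (CommutativeRing)
open import Algebra.Module.Bundles using (Module)
open import Data.Sum using (_⊎_)
open import Data.Product using (_×_)
open import Relation.Nullary using (¬_)

record IsIntegralDomain {a ℓ : Level} (A : CommutativeRing a ℓ) : Set (a ⊔ ℓ) where
  open CommutativeRing A
  field
    nontrivial     : ¬ (1# ≈ 0#)
    noZeroDivisors : ∀ x y → x * y ≈ 0# → (x ≈ 0#) ⊎ (y ≈ 0#)

module FractionField {a ℓ : Level} (A : CommutativeRing a ℓ)
                     (dom : IsIntegralDomain A) where
  open CommutativeRing A
  open IsIntegralDomain dom

  record K : Set (a ⊔ ℓ) where
    constructor _/_∣_
    field
      num    : Carrier
      den    : Carrier
      den≉0  : ¬ (den ≈ 0#)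
  open K public

  infix 4 _≈K_
  infixl 6 _+K_
  infixl 7 _*K_
  infixr 7 _·K_

  _≈K_ : K → K → Set ℓ
  x ≈K y = num x * den y ≈ num y * den x

  private
    den*den≉0 : ∀ {s t} → ¬ (s ≈ 0#) → ¬ (t ≈ 0#) → ¬ (s * t ≈ 0#)
    den*den≉0 {s} {t} s≉0 t≉0 st≈0 with noZeroDivisors s t st≈0
    ... | _⊎_.inj₁ p = s≉0 p
    ... | _⊎_.inj₂ q = t≉0 q

  _+K_ : K → K → K
  x +K y = (num x * den y + num y * den x) / (den x * den y)
             ∣ den*den≉0 (den≉0 x) (den≉0 y)

  _*K_ : K → K → K
  x *K y = (num x * num y) / (den x * den y)
             ∣ den*den≉0 (den≉0 x) (den≉0 y)

  ι : Carrier → K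
  ι r = r / 1# ∣ nontrivial

  _·K_ : Carrier → K → K
  r ·K x = ι r *K x

module _ {a ℓ : Level} (A : CommutativeRing a ℓ) (dom : IsIntegralDomain A) where
  open CommutativeRing A
  open FractionField A dom

  record IsInjectiveLinearToFrac {m ℓm : Level} (M : Module A m ℓm)
                                 (f : Module.Carrierᴹ M → K)
                                 : Set (a ⊔ ℓ ⊔ m ⊔ ℓm) where
    open Module M
    field
      cong       : ∀ {x y} → x ≈ᴹ y → f x ≈K f y
      additive   : ∀ x y → f (x +ᴹ y) ≈K f x +K f y
      homogenous : ∀ r x → f (r *ₗ x) ≈K r ·K f x
      injective  : ∀ {x y} → f x ≈K f y → x ≈ᴹ y

-- The A-linear map m : B ⊗_A C → A is given, equivalently via the
-- universal property of ⊗_A, as an A-bilinear map B × C → A.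

record GMA {a ℓ b ℓb c ℓc : Level} (A : CommutativeRing a ℓ)
           (B : Module A b ℓb) (C : Module A c ℓc)
           : Set (a ⊔ ℓ ⊔ b ⊔ ℓb ⊔ c ⊔ ℓc) where
  open CommutativeRing A
  module B = Module B
  module C = Module C
  field
    m      : B.Carrierᴹ → C.Carrierᴹ → Carrier
    m-cong : ∀ {b b' c c'} → b B.≈ᴹ b' → c C.≈ᴹ c' → m b c ≈ m b' c'
    m-+ˡ   : ∀ b b' c → m (b B.+ᴹ b') c ≈ m b c + m b' c
    m-+ʳ   : ∀ b c c' → m b (c C.+ᴹ c') ≈ m b c + m b c'
    m-*ˡ   : ∀ r b c → m (r B.*ₗ b) c ≈ r * m b c
    m-*ʳ   : ∀ r b c → m b (r C.*ₗ c) ≈ r * m b c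
    axiomB : ∀ b b' c → m b c B.*ₗ b' B.≈ᴹ m b' c B.*ₗ b
    axiomC : ∀ b c c' → m b c' C.*ₗ c C.≈ᴹ m b c C.*ₗ c'

  IsFaithful : Set (ℓ ⊔ b ⊔ ℓb ⊔ c ⊔ ℓc)
  IsFaithful = (∀ b → (∀ c → m b c ≈ 0#) → b B.≈ᴹ B.0ᴹ)
             × (∀ c → (∀ b → m b c ≈ 0#) → c C.≈ᴹ C.0ᴹ)

{-# OPTIONS --safe #-}
-- If m vanishes identically, faithfulness forces B = C = 0 and the zero maps
-- work.  Otherwise fix b₀, c₀ with d = m b₀ c₀ ≠ 0.  The axiom for B gives
-- m b c · d = m b c₀ · m b₀ c, so i b = m b c₀ and j c = m b₀ c / d factor m.
-- If i x = i y then m x c · d = m y c · d for every c, so m x = m y after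
-- cancelling d, and x = y by faithfulness; likewise for j.
module Submission where

open import Defs
open import Level using (Level)
open import Algebra.Bundles using (CommutativeRing)
open import Algebra.Module.Bundles using (Module)
open import Axiom.ExcludedMiddle using (ExcludedMiddle)
open import Data.Product using (_×_; ∃-syntax; _,_; proj₁; proj₂)
open import Data.Sum using (inj₁; inj₂)
open import Data.Empty using (⊥-elim)
open import Relation.Nullary using (¬_; yes; no)
open import Relation.Nullary.Decidable using (decidable-stable)
import Algebra.Properties.Group as GroupProperties
import Algebra.Properties.Ring as RingProperties
import Relation.Binary.Reasoning.Setoid as SetoidReasoning

module IntegralDomainProperties {a ℓ : Level} (A : CommutativeRing a ℓ)
                                (dom : IsIntegralDomain A) where
  open CommutativeRing A
  open IsIntegralDomain dom
  open RingProperties ring using ([y-z]x≈yx-zx)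
  open SetoidReasoning setoid

  *-cancelʳ-≉0 : ∀ {d} → ¬ (d ≈ 0#) → ∀ x y → x * d ≈ y * d → x ≈ y
  *-cancelʳ-≉0 {d} d≉0 x y xd≈yd with noZeroDivisors (x - y) d [x-y]d≈0
    where
    [x-y]d≈0 : (x - y) * d ≈ 0#
    [x-y]d≈0 = begin
      (x - y) * d    ≈⟨ [y-z]x≈yx-zx d x y ⟩
      x * d - y * d  ≈⟨ +-congʳ xd≈yd ⟩
      y * d - y * d  ≈⟨ -‿inverseʳ (y * d) ⟩
      0#             ∎
  ... | inj₁ x-y≈0 = GroupProperties.x∙y⁻¹≈ε⇒x≈y +-group x y x-y≈0
  ... | inj₂ d≈0   = ⊥-elim (d≉0 d≈0)

module _ {a ℓ : Level} (A : CommutativeRing a ℓ) (dom : IsIntegralDomain A) where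
  open CommutativeRing A
  open FractionField A dom

  zero-isInjectiveLinearToFrac : ∀ {m ℓm} (M : Module A m ℓm)
    → (∀ x y → Module._≈ᴹ_ M x y)
    → IsInjectiveLinearToFrac A dom M (λ _ → ι 0#)
  zero-isInjectiveLinearToFrac M M-trivial = record
    { cong       = λ _ → refl
    ; additive   = λ _ _ → trans (zeroˡ _) (sym 0+0≈0)
    ; homogenous = λ r _ → trans (zeroˡ _) (sym (trans (*-identityʳ _) (zeroʳ r)))
    ; injective  = λ {x} {y} _ → M-trivial x y
    }
    where
    0+0≈0 : (0# * 1# + 0# * 1#) * 1# ≈ 0#
    0+0≈0 = trans (*-identityʳ _) (trans (+-cong (zeroˡ 1#) (zeroˡ 1#)) (+-identityʳ 0#))

module _ {a ℓ m ℓm : Level} (A : CommutativeRing a ℓ) (M : Module A m ℓm) where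
  open CommutativeRing A
  open Module M
  open SetoidReasoning setoid

  separating-family : ∀ {ι} {I : Set ι} (g : I → Carrierᴹ → Carrier)
    → (∀ i {x y} → x ≈ᴹ y → g i x ≈ g i y)
    → (∀ i x y → g i (x +ᴹ y) ≈ g i x + g i y)
    → (∀ z → (∀ i → g i z ≈ 0#) → z ≈ᴹ 0ᴹ)
    → ∀ x y → (∀ i → g i x ≈ g i y) → x ≈ᴹ y
  separating-family g g-cong g-+ kernel-trivial x y gx≈gy =
    GroupProperties.x∙y⁻¹≈ε⇒x≈y +ᴹ-group x y
      (kernel-trivial (x +ᴹ -ᴹ y) λ i →
        GroupProperties.identityˡ-unique +-group (g i (x +ᴹ -ᴹ y)) (g i y) (g[x-y]+gy≈gy i))
    where
    x-y+y≈x : (x +ᴹ -ᴹ y) +ᴹ y ≈ᴹ x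
    x-y+y≈x = ≈ᴹ-trans (+ᴹ-assoc x (-ᴹ y) y)
                (≈ᴹ-trans (+ᴹ-congˡ (-ᴹ‿inverseˡ y)) (+ᴹ-identityʳ x))

    g[x-y]+gy≈gy : ∀ i → g i (x +ᴹ -ᴹ y) + g i y ≈ g i y
    g[x-y]+gy≈gy i = begin
      g i (x +ᴹ -ᴹ y) + g i y   ≈⟨ sym (g-+ i (x +ᴹ -ᴹ y) y) ⟩
      g i ((x +ᴹ -ᴹ y) +ᴹ y)    ≈⟨ g-cong i x-y+y≈x ⟩
      g i x                  ≈⟨ gx≈gy i ⟩
      g i y                  ∎

module GMAProperties {a ℓ b ℓb c ℓc : Level} {A : CommutativeRing a ℓ}
                     {B : Module A b ℓb} {C : Module A c ℓc} (R : GMA A B C) where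
  open CommutativeRing A
  open GMA R
  open SetoidReasoning setoid

  m-factorise : ∀ b₀ c₀ b c → m b c * m b₀ c₀ ≈ m b c₀ * m b₀ c
  m-factorise b₀ c₀ b c = begin
    m b c * m b₀ c₀            ≈⟨ *-comm _ _ ⟩
    m b₀ c₀ * m b c            ≈⟨ sym (m-*ˡ _ b c) ⟩
    m (m b₀ c₀ B.*ₗ b) c       ≈⟨ m-cong (B.≈ᴹ-sym (axiomB b b₀ c₀)) C.≈ᴹ-refl ⟩
    m (m b c₀ B.*ₗ b₀) c       ≈⟨ m-*ˡ _ b₀ c ⟩
    m b c₀ * m b₀ c            ∎

  FactorsThroughFrac : IsIntegralDomain A → Set _
  FactorsThroughFrac dom = let open FractionField A dom in
    ∃[ i ] ∃[ j ]
      IsInjectiveLinearToFrac A dom B i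
      × IsInjectiveLinearToFrac A dom C j
      × (∀ b c → ι (m b c) ≈K i b *K j c)

  module Faithful (faithful : IsFaithful) where
    m-separatesˡ : ∀ x y → (∀ c → m x c ≈ m y c) → x B.≈ᴹ y
    m-separatesˡ = separating-family A B (λ c b → m b c) (λ _ p → m-cong p C.≈ᴹ-refl)
                     (λ c x y → m-+ˡ x y c) (proj₁ faithful)

    m-separatesʳ : ∀ x y → (∀ b → m b x ≈ m b y) → x C.≈ᴹ y
    m-separatesʳ = separating-family A C m (λ _ p → m-cong B.≈ᴹ-refl p) m-+ʳ (proj₂ faithful)

    module _ (dom : IsIntegralDomain A) where
      open FractionField A dom

      factorisation-of-zero : (∀ b c → m b c ≈ 0#) → FactorsThroughFrac dom
      factorisation-of-zero m≈0 =
        (λ _ → ι 0#) , (λ _ → ι 0#)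
        , zero-isInjectiveLinearToFrac A dom B B-trivial
        , zero-isInjectiveLinearToFrac A dom C C-trivial
        , λ b c → trans (*-congʳ (m≈0 b c))
                    (trans (zeroˡ _) (sym (trans (*-identityʳ _) (zeroˡ 0#))))
        where
        B-trivial : ∀ x y → x B.≈ᴹ y
        B-trivial x y = m-separatesˡ x y λ c → trans (m≈0 x c) (sym (m≈0 y c))
        C-trivial : ∀ x y → x C.≈ᴹ y
        C-trivial x y = m-separatesʳ x y λ b → trans (m≈0 b x) (sym (m≈0 b y))

      module _ (b₀ : B.Carrierᴹ) (c₀ : C.Carrierᴹ) (d≉0 : ¬ (m b₀ c₀ ≈ 0#)) where
        open IntegralDomainProperties A dom using (*-cancelʳ-≉0)
        open IsIntegralDomain dom using (nontrivial)
        private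
          d = m b₀ c₀

        embedB : B.Carrierᴹ → K
        embedB b = ι (m b c₀)

        embedC : C.Carrierᴹ → K
        embedC c = m b₀ c / d ∣ d≉0

        embedB-isInjectiveLinear : IsInjectiveLinearToFrac A dom B embedB
        embedB-isInjectiveLinear = record
          { cong       = λ x≈y → *-congʳ (m-cong x≈y C.≈ᴹ-refl)
          ; additive   = λ x y → trans (*-identityʳ-1*1 _) (trans (m-+ˡ x y c₀)
                           (sym (trans (*-identityʳ _) (+-cong (*-identityʳ _) (*-identityʳ _)))))
          ; homogenous = λ r x → trans (*-identityʳ-1*1 _) (trans (m-*ˡ r x c₀) (sym (*-identityʳ _)))
          ; injective  = λ {x} {y} ix≈iy → m-separatesˡ x y λ c →
              *-cancelʳ-≉0 d≉0 _ _ (begin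
                m x c * d          ≈⟨ m-factorise b₀ c₀ x c ⟩
                m x c₀ * m b₀ c    ≈⟨ *-congʳ (*-cancelʳ-≉0 nontrivial _ _ ix≈iy) ⟩
                m y c₀ * m b₀ c    ≈⟨ m-factorise b₀ c₀ y c ⟨
                m y c * d          ∎)
          }
          where
          *-identityʳ-1*1 : ∀ x → x * (1# * 1#) ≈ x
          *-identityʳ-1*1 x = trans (*-congˡ (*-identityʳ 1#)) (*-identityʳ x)

        embedC-isInjectiveLinear : IsInjectiveLinearToFrac A dom C embedC
        embedC-isInjectiveLinear = record
          { cong       = λ x≈y → *-congʳ (m-cong B.≈ᴹ-refl x≈y)
          ; additive   = λ x y → begin
              m b₀ (x C.+ᴹ y) * (d * d)           ≈⟨ *-congʳ (m-+ʳ b₀ x y) ⟩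
              (m b₀ x + m b₀ y) * (d * d)         ≈⟨ *-assoc _ _ _ ⟨
              (m b₀ x + m b₀ y) * d * d           ≈⟨ *-congʳ (distribʳ d _ _) ⟩
              (m b₀ x * d + m b₀ y * d) * d       ∎
          ; homogenous = λ r x → *-cong (m-*ʳ r b₀ x) (*-identityˡ d)
          ; injective  = λ {x} {y} jx≈jy → m-separatesʳ x y λ b →
              *-cancelʳ-≉0 d≉0 _ _ (begin
                m b x * d          ≈⟨ m-factorise b₀ c₀ b x ⟩
                m b c₀ * m b₀ x    ≈⟨ *-congˡ (*-cancelʳ-≉0 d≉0 _ _ jx≈jy) ⟩
                m b c₀ * m b₀ y    ≈⟨ m-factorise b₀ c₀ b y ⟨
                m b y * d          ∎)
          }

        m≈embedB*embedC : ∀ b c → ι (m b c) ≈K embedB b *K embedC c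
        m≈embedB*embedC b c =
          trans (*-congˡ (*-identityˡ d)) (trans (m-factorise b₀ c₀ b c) (sym (*-identityʳ _)))

        factorisation-through : FactorsThroughFrac dom
        factorisation-through =
          embedB , embedC , embedB-isInjectiveLinear , embedC-isInjectiveLinear , m≈embedB*embedC

lemma2p4 : (lem : ∀ {p} → ExcludedMiddle p)
    → {a ℓ b ℓb c ℓc : Level}
    → (A : CommutativeRing a ℓ) (dom : IsIntegralDomain A)
    → (B : Module A b ℓb) (C : Module A c ℓc)
    → (R : GMA A B C) → GMA.IsFaithful R
    → let open FractionField A dom in
      ∃[ i ] ∃[ j ]
        IsInjectiveLinearToFrac A dom B i
        × IsInjectiveLinearToFrac A dom C j
        × (∀ b c → ι (GMA.m R b c) ≈K i b *K j c)
lemma2p4 lem A dom B C R faithful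
  with lem {P = ∃[ b₀ ] ∃[ c₀ ] ¬ (m b₀ c₀ ≈ 0#)}
  where open CommutativeRing A
        open GMA R
... | yes (b₀ , c₀ , d≉0) = factorisation-through dom b₀ c₀ d≉0
  where open GMAProperties.Faithful R faithful
... | no m-nowhere-nonzero = factorisation-of-zero dom m≈0
  where
  open CommutativeRing A
  open GMA R
  open GMAProperties.Faithful R faithful
  m≈0 : ∀ b c → m b c ≈ 0#
  m≈0 b c = decidable-stable lem λ m≉0 → m-nowhere-nonzero (b , c , m≉0)
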